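{- Let $n,k,m,r$ be positive integers with $r\le k-1$ and $k\le m$. Let $\mathcal C=\{C_1,\dots,C_m\}$ be an $(n,N,k,m;r)$-MCBC, and for each integer $i\ge 0$ let $A_i$ be the number of items $\ell\in[n]$ that are stored in exactly $i$ servers, i.e. $A_i=|\{\ell\in[n]: |\{j: \ell\in C_j\}|=i\}|$. Then $$\sum_{i=r}^{k-1}{m-i\choose k-1-i}A_i\leq \left\lfloor\frac{k-1}{r}\right\rfloor{m\choose k-1}.$$
   Context: An $(n,N,k,m;r)$ multiset combinatorial batch code (MCBC) is a collection $\mathcal C=\{C_1,\dots,C_m\}$ of subsets of $[n]=\{1,\dots,n\}$ (servers) with $N=\sum_{j=1}^m|C_j|$, such that for every multiset request $\{i_1,\dots,i_k\}$ of $k$ elements of $[n]$ in which every element has multiplicity at most $r$, there exist subsets $D_j\subseteq C_j$ with $|D_j|\le 1$ ($j\in[m]$) whose multiset union (the multiplicity of $i$ being $|\{j: i\in D_j\}|$) contains the request. -}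

module Defs where

open import Data.Nat using (ℕ; zero; suc; _+_; _≤_; _≟_)
open import Data.Fin using (Fin)
open import Data.Fin.Subset using (Subset; _∈_; ∣_∣)
open import Data.Fin.Subset.Properties using (_∈?_)
open import Data.Maybe using (Maybe; just; nothing)
open import Data.Vec.Functional using (Vector)
open import Data.List using (List; length; filter; map)
open import Data.Nat.ListAction using (sum)
open import Data.List using (allFin)
open import Relation.Binary.PropositionalEquality using (_≡_)
open import Relation.Nullary.Decidable using (Dec; yes; no)
open import Data.Product using (Σ; _×_)

countFin : (n : ℕ) → (P : Fin n → Set) → ((x : Fin n) → Dec (P x)) → ℕ
countFin n P P? = length (filter P? (allFin n))

sumFin : (n : ℕ) → (Fin n → ℕ) → ℕ
sumFin n f = sum (map f (allFin n))

Code : ℕ → ℕ → Set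
Code n m = Fin m → Subset n

degree : ∀ {n m} → Code n m → Fin n → ℕ
degree {n} {m} C ℓ = countFin m (λ j → ℓ ∈ C j) (λ j → ℓ ∈? C j)

storage : ∀ {n m} → Code n m → ℕ
storage {n} {m} C = sumFin m (λ j → ∣ C j ∣)

-- a multiset request of size k over [n] with all multiplicities ≤ r
-- (given by its multiplicity function)
IsRequest : (n k r : ℕ) → (Fin n → ℕ) → Set
IsRequest n k r req = (sumFin n req ≡ k) × ((i : Fin n) → req i ≤ r)

-- a choice of D_j ⊆ C_j with |D_j| ≤ 1: D j = nothing (empty) or just i (D_j = {i})
IsChoice : ∀ {n m} → Code n m → (Fin m → Maybe (Fin n)) → Set
IsChoice {n} {m} C D = (j : Fin m) (i : Fin n) → D j ≡ just i → i ∈ C j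

mult : ∀ {n m} → (Fin m → Maybe (Fin n)) → Fin n → ℕ
mult {n} {m} D i = countFin m (λ j → D j ≡ just i) (λ j → Data.Maybe.Properties.≡-dec Data.Fin._≟_ (D j) (just i))
  where import Data.Maybe.Properties
        import Data.Fin

IsMCBC : (n N k m r : ℕ) → Code n m → Set
IsMCBC n N k m r C =
  (storage C ≡ N) ×
  ((req : Fin n → ℕ) → IsRequest n k r req →
     Σ (Fin m → Maybe (Fin n)) λ D → IsChoice C D × ((i : Fin n) → req i ≤ mult D i))

A : ∀ {n m} → Code n m → ℕ → ℕ
A {n} C i = countFin n (λ ℓ → degree C ℓ ≡ i) (λ ℓ → degree C ℓ ≟ i)

-- sumFrom a c f = f a + f (a+1) + ... + f (a+c-1)   (c terms)
sumFrom : ℕ → ℕ → (ℕ → ℕ) → ℕ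
sumFrom a zero f = 0
sumFrom a (suc c) f = f a + sumFrom (suc a) c f

module Submission where

-- Proof idea.  Write K = k - 1 and, for an item ℓ, let T ℓ ⊆ [m] be the set of
-- servers storing ℓ, so that the degree of ℓ is |T ℓ|.
--
--  * Key fact (fewItemsInside): for every set S of at most K servers, at most
--    ⌊K/r⌋ items have all their servers inside S.  Otherwise one can spread a
--    request of size k = K + 1 over those items with multiplicity ≤ r each;
--    every server used to serve it lies in S and serves one copy, so |S| ≥ k.
--  * Double counting (supersetBound): if every K-subset S of [m] contains at
--    most c of the sets T ℓ, then Σ_ℓ #{K-subsets containing T ℓ} ≤ c·C(m,K).
--    The number of K-supersets of a set v is defined by the recursion deciding
--    whether the first server belongs to S; it equals C(m-|v|, K-|v|) when
--    |v| ≤ K (supersets-closed), and the bound follows by induction on m.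
--  * The left-hand side of the theorem is Σ_ℓ C(m-d, K-d)·[r ≤ d ≤ K] with
--    d = |T ℓ|, and each summand is at most the number of K-supersets of T ℓ.

open import Data.Bool using (Bool; true; false; not; _∧_)
open import Data.Empty using (⊥-elim)
open import Data.Fin using (Fin; zero; suc)
open import Data.Fin.Properties using () renaming (_≟_ to _≟ᶠ_)
open import Data.Fin.Subset using (Subset; inside; outside; _∈_; ∣_∣)
open import Data.Fin.Subset.Properties using (_∈?_; _⊆?_; ∣p∣≤n)
import Data.List as List
open import Data.Maybe using (Maybe; just; nothing)
open import Data.Maybe.Properties using (≡-dec)
open import Data.Nat
open import Data.Nat.Combinatorics using (_C_; nCk+nC[k+1]≡[n+1]C[k+1])
open import Data.Nat.DivMod using (/-monoˡ-≤; m*n/n≡m)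
open import Data.Nat.ListAction using (sum)
open import Data.Nat.Properties
open import Data.Product using (_,_; _×_; Σ-syntax)
open import Data.Sum using (inj₁; inj₂)
open import Data.Vec using ([]; _∷_; head; tail; lookup; tabulate)
open import Data.Vec.Properties using (lookup∘tabulate; lookup⇒[]=; []=⇒lookup)
open import Function using (_∘_; id)
open import Relation.Binary.PropositionalEquality
open import Relation.Nullary using (does; yes; no; Dec)
open import Relation.Nullary.Decidable using (dec-true; dec-false)

open import Algebra.Properties.Semiring.Sum +-*-semiring
  using (sum-syntax; sum-cong-≗; sum-replicate-zero; ∑-distrib-+; ∑-comm; *-distribˡ-sum; *-distribʳ-sum)

open import Defs

open ≤-Reasoning

𝟙 : Bool → ℕ
𝟙 true  = 1
𝟙 false = 0

𝟙*≤ : ∀ b x → 𝟙 b * x ≤ x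
𝟙*≤ true  x = ≤-reflexive (+-identityʳ x)
𝟙*≤ false x = z≤n

≤-𝟙* : ∀ b {x y z} → x ≤ 𝟙 b * y → x ≤ z → x ≤ 𝟙 b * z
≤-𝟙* true  _   x≤z = ≤-trans x≤z (≤-reflexive (sym (+-identityʳ _)))
≤-𝟙* false x≤0 _   = x≤0

𝟙-weigh : ∀ p q x y → 𝟙 p * (𝟙 q * x + y) ≡ 𝟙 (p ∧ q) * x + 𝟙 p * y
𝟙-weigh true  q x y = trans (+-identityʳ _) (cong (𝟙 q * x +_) (sym (+-identityʳ y)))
𝟙-weigh false q x y = refl

𝟙-weigh₁ : ∀ p q x → 𝟙 p * (𝟙 q * x) ≡ 𝟙 (p ∧ q) * x
𝟙-weigh₁ true  q x = +-identityʳ _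
𝟙-weigh₁ false q x = refl

∑-mono-≤ : ∀ {n} {f g : Fin n → ℕ} → (∀ i → f i ≤ g i) → ∑[ i < n ] f i ≤ ∑[ i < n ] g i
∑-mono-≤ {zero}  f≤g = z≤n
∑-mono-≤ {suc n} f≤g = +-mono-≤ (f≤g zero) (∑-mono-≤ (f≤g ∘ suc))

∑-null : ∀ {n} {f : Fin n → ℕ} → (∀ i → f i ≡ 0) → ∑[ i < n ] f i ≡ 0
∑-null {n} f≡0 = trans (sum-cong-≗ f≡0) (sum-replicate-zero n)

∑-δ : ∀ {n} (f : Fin n → ℕ) (x : Fin n) → ∑[ i < n ] (f i * 𝟙 (does (x ≟ᶠ i))) ≡ f x
∑-δ {suc n} f zero =
  trans (cong₂ _+_ (*-identityʳ (f zero)) (∑-null (λ i → *-zeroʳ (f (suc i)))))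
        (+-identityʳ (f zero))
∑-δ {suc n} f (suc x) = trans (cong₂ _+_ (*-zeroʳ (f zero)) refl) (∑-δ (f ∘ suc) x)

sum-map-tabulate : ∀ {n} {X : Set} (g : X → ℕ) (f : Fin n → X) →
  sum (List.map g (List.tabulate f)) ≡ ∑[ i < n ] g (f i)
sum-map-tabulate {zero}  g f = refl
sum-map-tabulate {suc n} g f = cong (g (f zero) +_) (sum-map-tabulate g (f ∘ suc))

length-filter-tabulate : ∀ {n} {X : Set} {P : X → Set} (P? : ∀ x → Dec (P x)) (f : Fin n → X) →
  List.length (List.filter P? (List.tabulate f)) ≡ ∑[ i < n ] 𝟙 (does (P? (f i)))
length-filter-tabulate {zero}  P? f = refl
length-filter-tabulate {suc n} P? f with does (P? (f zero))
... | true  = cong suc (length-filter-tabulate P? (f ∘ suc))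
... | false = length-filter-tabulate P? (f ∘ suc)

sumFin≡∑ : ∀ n (f : Fin n → ℕ) → sumFin n f ≡ ∑[ i < n ] f i
sumFin≡∑ n f = sum-map-tabulate f id

countFin≡∑ : ∀ n (P : Fin n → Set) (P? : ∀ i → Dec (P i)) → countFin n P P? ≡ ∑[ i < n ] 𝟙 (does (P? i))
countFin≡∑ n P P? = length-filter-tabulate P? id

sumFrom-cong : ∀ a c {f g : ℕ → ℕ} → (∀ i → f i ≡ g i) → sumFrom a c f ≡ sumFrom a c g
sumFrom-cong a zero    f≡g = refl
sumFrom-cong a (suc c) f≡g = cong₂ _+_ (f≡g a) (sumFrom-cong (suc a) c f≡g)

sumFrom-∑ : ∀ {n} a c (F : ℕ → Fin n → ℕ) →
  sumFrom a c (λ i → ∑[ ℓ < n ] F i ℓ) ≡ ∑[ ℓ < n ] sumFrom a c (λ i → F i ℓ)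
sumFrom-∑ {n} a zero    F = sym (sum-replicate-zero n)
sumFrom-∑ {n} a (suc c) F =
  trans (cong (∑[ ℓ < n ] F a ℓ +_) (sumFrom-∑ (suc a) c F)) (sym (∑-distrib-+ (F a) _))

δ : ℕ → ℕ → ℕ
δ d i = 𝟙 (does (d ≟ i))

δ-refl : ∀ d → δ d d ≡ 1
δ-refl d = cong 𝟙 (dec-true (d ≟ d) refl)

δ-≢ : ∀ {d i} → d ≢ i → δ d i ≡ 0
δ-≢ {d} {i} d≢i = cong 𝟙 (dec-false (d ≟ i) d≢i)

sumFrom-δ-outside : ∀ a c (g : ℕ → ℕ) d → (∀ i → a ≤ i → i < a + c → d ≢ i) →
  sumFrom a c (λ i → g i * δ d i) ≡ 0
sumFrom-δ-outside a zero    g d d∉ = refl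
sumFrom-δ-outside a (suc c) g d d∉ =
  cong₂ _+_ (trans (cong (g a *_) (δ-≢ (d∉ a ≤-refl (m<m+n a z<s)))) (*-zeroʳ (g a)))
            (sumFrom-δ-outside (suc a) c g d d∉′)
  where
  d∉′ : ∀ i → suc a ≤ i → i < suc a + c → d ≢ i
  d∉′ i a<i i<a+c = d∉ i (<⇒≤ a<i) (≤-trans i<a+c (≤-reflexive (sym (+-suc a c))))

sumFrom-δ-≤ : ∀ a c (g : ℕ → ℕ) d → sumFrom a c (λ i → g i * δ d i) ≤ g d
sumFrom-δ-≤ a zero    g d = z≤n
sumFrom-δ-≤ a (suc c) g d with d ≟ a
... | yes refl = ≤-reflexive (trans (cong₂ _+_ (trans (cong (g d *_) (δ-refl d)) (*-identityʳ (g d))) rest≡0)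
                                    (+-identityʳ (g d)))
  where
  rest≡0 : sumFrom (suc d) c (λ i → g i * δ d i) ≡ 0
  rest≡0 = sumFrom-δ-outside (suc d) c g d (λ i d<i _ d≡i → <-irrefl d≡i d<i)
... | no d≢a   = ≤-trans (≤-reflexive (cong₂ _+_ (trans (cong (g a *_) (δ-≢ d≢a)) (*-zeroʳ (g a))) refl))
                         (sumFrom-δ-≤ (suc a) c g d)

∣∣≡∑ : ∀ {m} (S : Subset m) → ∣ S ∣ ≡ ∑[ j < m ] 𝟙 (lookup S j)
∣∣≡∑ []            = refl
∣∣≡∑ (inside  ∷ S) = cong suc (∣∣≡∑ S)
∣∣≡∑ (outside ∷ S) = ∣∣≡∑ S

-- supersets K v is the number of K-element subsets S of [m] with v ⊆ S:
-- either the first point is outside S (allowed only if it is outside v) or inside S.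
supersets : ∀ {m} → ℕ → Subset m → ℕ
supersets zero    []      = 1
supersets (suc K) []      = 0
supersets zero    (b ∷ v) = 𝟙 (not b) * supersets zero v
supersets (suc K) (b ∷ v) = 𝟙 (not b) * supersets (suc K) v + supersets K v

supersets-vanish : ∀ {m} K (v : Subset m) → K < ∣ v ∣ → supersets K v ≡ 0
supersets-vanish zero    (inside  ∷ v) _          = refl
supersets-vanish (suc K) (inside  ∷ v) (s≤s K<∣v∣) = supersets-vanish K v K<∣v∣
supersets-vanish zero    (outside ∷ v) 0<∣v∣      =
  trans (*-identityˡ _) (supersets-vanish zero v 0<∣v∣)
supersets-vanish (suc K) (outside ∷ v) K<∣v∣      =
  cong₂ _+_ (trans (*-identityˡ _) (supersets-vanish (suc K) v K<∣v∣)) (supersets-vanish K v (<⇒≤ K<∣v∣))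

C-at-zero : ∀ {t} x y → t ≡ 0 → x C t ≡ y C t
C-at-zero x y refl = refl

pascal-shifted : ∀ {m K d} → d ≤ K → d ≤ m →
  (m ∸ d) C (suc K ∸ d) + (m ∸ d) C (K ∸ d) ≡ (suc m ∸ d) C (suc K ∸ d)
pascal-shifted {m} {K} {d} d≤K d≤m = begin-equality
  (m ∸ d) C (suc K ∸ d) + (m ∸ d) C (K ∸ d)
    ≡⟨ cong (λ t → (m ∸ d) C t + (m ∸ d) C (K ∸ d)) (+-∸-assoc 1 d≤K) ⟩
  (m ∸ d) C suc (K ∸ d) + (m ∸ d) C (K ∸ d)       ≡⟨ +-comm ((m ∸ d) C suc (K ∸ d)) _ ⟩
  (m ∸ d) C (K ∸ d) + (m ∸ d) C suc (K ∸ d)       ≡⟨ nCk+nC[k+1]≡[n+1]C[k+1] (m ∸ d) (K ∸ d) ⟩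
  suc (m ∸ d) C suc (K ∸ d)                       ≡⟨ cong₂ _C_ (+-∸-assoc 1 d≤m) (+-∸-assoc 1 d≤K) ⟨
  (suc m ∸ d) C (suc K ∸ d)                       ∎

supersets-closed : ∀ {m} K (v : Subset m) → ∣ v ∣ ≤ K → supersets K v ≡ (m ∸ ∣ v ∣) C (K ∸ ∣ v ∣)
supersets-closed zero    []            _          = refl
supersets-closed (suc K) []            _          = refl
supersets-closed (suc K) (inside ∷ v)  (s≤s d≤K)  = supersets-closed K v d≤K
supersets-closed {suc m} zero (outside ∷ v) d≤0 =
  trans (*-identityˡ _) (trans (supersets-closed zero v d≤0)
                               (C-at-zero (m ∸ ∣ v ∣) (suc m ∸ ∣ v ∣) (0∸n≡0 ∣ v ∣)))
supersets-closed {suc m} (suc K) (outside ∷ v) d≤1+K with m≤n⇒m<n∨m≡n d≤1+K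
... | inj₁ (s≤s d≤K) =
  trans (cong₂ _+_ (trans (*-identityˡ _) (supersets-closed (suc K) v d≤1+K)) (supersets-closed K v d≤K))
        (pascal-shifted d≤K (∣p∣≤n v))
... | inj₂ d≡1+K =
  trans (cong₂ _+_ (trans (*-identityˡ _) (supersets-closed (suc K) v d≤1+K))
                   (supersets-vanish K v (≤-reflexive (sym d≡1+K))))
  (trans (+-identityʳ _)
         (C-at-zero (m ∸ ∣ v ∣) (suc m ∸ ∣ v ∣) (m≤n⇒m∸n≡0 (≤-reflexive (sym d≡1+K)))))

countInside : ∀ {n m} → (Fin n → Bool) → (Fin n → Subset m) → Subset m → ℕ
countInside {n} P T S = ∑[ ℓ < n ] 𝟙 (P ℓ ∧ does (T ℓ ⊆? S))

countInside-outside : ∀ {n m} (P : Fin n → Bool) (T : Fin n → Subset (suc m)) (S : Subset m) →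
  countInside (λ ℓ → P ℓ ∧ not (head (T ℓ))) (tail ∘ T) S ≡ countInside P T (outside ∷ S)
countInside-outside P T S = sum-cong-≗ (λ ℓ → cong 𝟙 (pointwise (P ℓ) (T ℓ)))
  where
  pointwise : ∀ p v → (p ∧ not (head v)) ∧ does (tail v ⊆? S) ≡ p ∧ does (v ⊆? outside ∷ S)
  pointwise true  (inside  ∷ v) = refl
  pointwise true  (outside ∷ v) = refl
  pointwise false (_       ∷ v) = refl

countInside-inside : ∀ {n m} (P : Fin n → Bool) (T : Fin n → Subset (suc m)) (S : Subset m) →
  countInside P (tail ∘ T) S ≡ countInside P T (inside ∷ S)
countInside-inside P T S = sum-cong-≗ (λ ℓ → cong (λ b → 𝟙 (P ℓ ∧ b)) (pointwise (T ℓ)))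
  where
  pointwise : ∀ v → does (tail v ⊆? S) ≡ does (v ⊆? inside ∷ S)
  pointwise (inside  ∷ v) = refl
  pointwise (outside ∷ v) = refl

supersetBound : ∀ {n} m K c (P : Fin n → Bool) (T : Fin n → Subset m) →
  (∀ S → ∣ S ∣ ≡ K → countInside P T S ≤ c) →
  ∑[ ℓ < n ] (𝟙 (P ℓ) * supersets K (T ℓ)) ≤ c * (m C K)
supersetBound zero zero c P T few = begin
  ∑[ ℓ < _ ] (𝟙 (P ℓ) * supersets 0 (T ℓ)) ≡⟨ sum-cong-≗ (λ ℓ → empty (P ℓ) (T ℓ)) ⟩
  countInside P T []                      ≤⟨ few [] refl ⟩
  c                                       ≡⟨ *-identityʳ c ⟨
  c * 1                                   ∎
  where
  empty : ∀ p (v : Subset 0) → 𝟙 p * supersets 0 v ≡ 𝟙 (p ∧ does (v ⊆? []))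
  empty true  [] = refl
  empty false [] = refl
supersetBound zero (suc K) c P T few = ≤-trans (≤-reflexive (∑-null (λ ℓ → none (P ℓ) (T ℓ)))) z≤n
  where
  none : ∀ p (v : Subset 0) → 𝟙 p * supersets (suc K) v ≡ 0
  none p [] = *-zeroʳ (𝟙 p)
supersetBound (suc m) zero c P T few = begin
  ∑[ ℓ < _ ] (𝟙 (P ℓ) * supersets 0 (T ℓ))
    ≡⟨ sum-cong-≗ (λ ℓ → split (P ℓ) (T ℓ)) ⟩
  ∑[ ℓ < _ ] (𝟙 (P ℓ ∧ not (head (T ℓ))) * supersets 0 (tail (T ℓ)))
    ≤⟨ supersetBound m zero c _ (tail ∘ T) (λ S ∣S∣≡0 →
         ≤-trans (≤-reflexive (countInside-outside P T S)) (few (outside ∷ S) ∣S∣≡0)) ⟩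
  c * 1 ∎
  where
  split : ∀ p v → 𝟙 p * supersets 0 v ≡ 𝟙 (p ∧ not (head v)) * supersets 0 (tail v)
  split p (b ∷ v) = 𝟙-weigh₁ p (not b) _
supersetBound (suc m) (suc K) c P T few = begin
  ∑[ ℓ < _ ] (𝟙 (P ℓ) * supersets (suc K) (T ℓ))
    ≡⟨ sum-cong-≗ (λ ℓ → split (P ℓ) (T ℓ)) ⟩
  ∑[ ℓ < _ ] (𝟙 (P ℓ ∧ not (head (T ℓ))) * supersets (suc K) (tail (T ℓ))
              + 𝟙 (P ℓ) * supersets K (tail (T ℓ)))
    ≡⟨ ∑-distrib-+ (λ ℓ → 𝟙 (P ℓ ∧ not (head (T ℓ))) * supersets (suc K) (tail (T ℓ)))
                   (λ ℓ → 𝟙 (P ℓ) * supersets K (tail (T ℓ))) ⟩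
  ∑[ ℓ < _ ] (𝟙 (P ℓ ∧ not (head (T ℓ))) * supersets (suc K) (tail (T ℓ)))
    + ∑[ ℓ < _ ] (𝟙 (P ℓ) * supersets K (tail (T ℓ)))
    ≤⟨ +-mono-≤ outsideBound insideBound ⟩
  c * (m C suc K) + c * (m C K)
    ≡⟨ trans (+-comm (c * (m C suc K)) (c * (m C K))) (sym (*-distribˡ-+ c (m C K) (m C suc K))) ⟩
  c * (m C K + m C suc K)
    ≡⟨ cong (c *_) (nCk+nC[k+1]≡[n+1]C[k+1] m K) ⟩
  c * (suc m C suc K) ∎
  where
  split : ∀ p v → 𝟙 p * supersets (suc K) v
                ≡ 𝟙 (p ∧ not (head v)) * supersets (suc K) (tail v) + 𝟙 p * supersets K (tail v)
  split p (b ∷ v) = 𝟙-weigh p (not b) _ _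
  outsideBound = supersetBound m (suc K) c _ (tail ∘ T) (λ S ∣S∣≡1+K →
    ≤-trans (≤-reflexive (countInside-outside P T S)) (few (outside ∷ S) ∣S∣≡1+K))
  insideBound = supersetBound m K c P (tail ∘ T) (λ S ∣S∣≡K →
    ≤-trans (≤-reflexive (countInside-inside P T S)) (few (inside ∷ S) (cong suc ∣S∣≡K)))

supersetBound-all : ∀ {n} m K c (T : Fin n → Subset m) →
  (∀ S → ∣ S ∣ ≡ K → ∑[ ℓ < n ] 𝟙 (does (T ℓ ⊆? S)) ≤ c) →
  ∑[ ℓ < n ] supersets K (T ℓ) ≤ c * (m C K)
supersetBound-all m K c T few =
  ≤-trans (≤-reflexive (sum-cong-≗ (λ ℓ → sym (*-identityˡ (supersets K (T ℓ))))))
          (supersetBound m K c (λ _ → true) T few)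

servers : ∀ {n m} → Code n m → Fin n → Subset m
servers 𝒞 ℓ = tabulate (λ j → does (ℓ ∈? 𝒞 j))

∈-servers : ∀ {n m} (𝒞 : Code n m) {ℓ j} → ℓ ∈ 𝒞 j → j ∈ servers 𝒞 ℓ
∈-servers 𝒞 {ℓ} {j} ℓ∈C =
  lookup⇒[]= j (servers 𝒞 ℓ) (trans (lookup∘tabulate _ j) (dec-true (ℓ ∈? 𝒞 j) ℓ∈C))

∣servers∣≡degree : ∀ {n m} (𝒞 : Code n m) ℓ → ∣ servers 𝒞 ℓ ∣ ≡ degree 𝒞 ℓ
∣servers∣≡degree {m = m} 𝒞 ℓ =
  trans (∣∣≡∑ (servers 𝒞 ℓ))
  (trans (sum-cong-≗ (λ j → cong 𝟙 (lookup∘tabulate (λ j → does (ℓ ∈? 𝒞 j)) j)))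
         (sym (countFin≡∑ m _ (λ j → ℓ ∈? 𝒞 j))))

A≡∑ : ∀ {n m} (𝒞 : Code n m) i → A 𝒞 i ≡ ∑[ ℓ < n ] δ ∣ servers 𝒞 ℓ ∣ i
A≡∑ {n} 𝒞 i =
  trans (countFin≡∑ n _ (λ ℓ → degree 𝒞 ℓ ≟ i))
        (sum-cong-≗ (λ ℓ → cong (λ d → δ d i) (sym (∣servers∣≡degree 𝒞 ℓ))))

spread : ∀ {n} (cap : Fin n → ℕ) (b : ℕ) → b ≤ ∑[ i < n ] cap i →
  Σ[ part ∈ (Fin n → ℕ) ] (∑[ i < n ] part i ≡ b × (∀ i → part i ≤ cap i))
spread {zero}  cap b b≤0 = (λ ()) , sym (n≤0⇒n≡0 b≤0) , λ ()
spread {suc n} cap b b≤∑ with spread (cap ∘ suc) (b ∸ cap zero) (m≤n+o⇒m∸n≤o b (cap zero) b≤∑)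
... | rest , ∑rest≡ , rest≤ =
  part , trans (cong (cap zero ⊓ b +_) ∑rest≡) (m⊓n+n∸m≡n (cap zero) b) , part≤
  where
  part : Fin (suc n) → ℕ
  part zero    = cap zero ⊓ b
  part (suc i) = rest i
  part≤ : ∀ i → part i ≤ cap i
  part≤ zero    = m⊓n≤m (cap zero) b
  part≤ (suc i) = rest≤ i

storedInside : ∀ {n m} → Code n m → Subset m → Fin n → Bool
storedInside 𝒞 S ℓ = does (servers 𝒞 ℓ ⊆? S)

-- A valid choice D serves the items stored inside S at most |S| times in total:
-- each server in S serves at most one copy, and no server outside S serves them.
served-inside : ∀ {n m} (𝒞 : Code n m) (D : Fin m → Maybe (Fin n)) → IsChoice 𝒞 D → (S : Subset m) →
  ∑[ ℓ < n ] (𝟙 (storedInside 𝒞 S ℓ) * mult D ℓ) ≤ ∣ S ∣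
served-inside {n} {m} 𝒞 D choice S = begin
  ∑[ ℓ < n ] (q ℓ * mult D ℓ)              ≡⟨ sum-cong-≗ (λ ℓ → trans (cong (q ℓ *_) (countFin≡∑ m _ (picks? ℓ)))
                                                                  (*-distribˡ-sum (q ℓ) (λ j → picks j ℓ))) ⟩
  ∑[ ℓ < n ] ∑[ j < m ] (q ℓ * picks j ℓ)  ≡⟨ ∑-comm (λ ℓ j → q ℓ * picks j ℓ) ⟩
  ∑[ j < m ] ∑[ ℓ < n ] (q ℓ * picks j ℓ)  ≤⟨ ∑-mono-≤ perServer ⟩
  ∑[ j < m ] 𝟙 (lookup S j)                ≡⟨ ∣∣≡∑ S ⟨
  ∣ S ∣                                    ∎
  where
  q : Fin n → ℕ
  q ℓ = 𝟙 (storedInside 𝒞 S ℓ)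
  picks? : ∀ ℓ j → Dec (D j ≡ just ℓ)
  picks? ℓ j = ≡-dec _≟ᶠ_ (D j) (just ℓ)
  picks : Fin m → Fin n → ℕ
  picks j ℓ = 𝟙 (does (picks? ℓ j))
  perServer : ∀ j → ∑[ ℓ < n ] (q ℓ * picks j ℓ) ≤ 𝟙 (lookup S j)
  perServer j with D j in Dj≡
  ... | nothing = ≤-trans (≤-reflexive (∑-null (λ ℓ → *-zeroʳ (q ℓ)))) z≤n
  ... | just x  = ≤-trans (≤-reflexive (∑-δ q x)) (servedBy (choice j x Dj≡))
    where
    servedBy : x ∈ 𝒞 j → q x ≤ 𝟙 (lookup S j)
    servedBy x∈C with servers 𝒞 x ⊆? S
    ... | yes T⊆S = ≤-reflexive (cong 𝟙 (sym ([]=⇒lookup (T⊆S (∈-servers 𝒞 x∈C)))))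
    ... | no  _   = z≤n

requestInside : ∀ {n N k m r} (𝒞 : Code n m) → IsMCBC n N k m r 𝒞 → (S : Subset m) →
  k ≤ (∑[ ℓ < n ] 𝟙 (storedInside 𝒞 S ℓ)) * r → k ≤ ∣ S ∣
requestInside {n} {k = k} {r = r} 𝒞 (_ , serve) S k≤
  with spread (λ ℓ → 𝟙 (storedInside 𝒞 S ℓ) * r) k
              (≤-trans k≤ (≤-reflexive (*-distribʳ-sum r (λ ℓ → 𝟙 (storedInside 𝒞 S ℓ)))))
... | req , ∑req≡k , req≤cap
  with serve req (trans (sumFin≡∑ n req) ∑req≡k ,
                  λ ℓ → ≤-trans (req≤cap ℓ) (𝟙*≤ (storedInside 𝒞 S ℓ) r))
... | D , choice , covers = begin
  k
    ≡⟨ ∑req≡k ⟨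
  ∑[ ℓ < n ] req ℓ
    ≤⟨ ∑-mono-≤ (λ ℓ → ≤-𝟙* (storedInside 𝒞 S ℓ) (req≤cap ℓ) (covers ℓ)) ⟩
  ∑[ ℓ < n ] (𝟙 (storedInside 𝒞 S ℓ) * mult D ℓ)
    ≤⟨ served-inside 𝒞 D choice S ⟩
  ∣ S ∣ ∎

fewItemsInside : ∀ {n N K m} r .{{_ : NonZero r}} (𝒞 : Code n m) → IsMCBC n N (suc K) m r 𝒞 →
  (S : Subset m) → ∣ S ∣ ≤ K → ∑[ ℓ < n ] 𝟙 (storedInside 𝒞 S ℓ) ≤ K / r
fewItemsInside {n} {K = K} r 𝒞 isMCBC S ∣S∣≤K with (∑[ ℓ < n ] 𝟙 (storedInside 𝒞 S ℓ)) * r ≤? K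
... | yes t*r≤K = ≤-trans (≤-reflexive (sym (m*n/n≡m _ r))) (/-monoˡ-≤ r t*r≤K)
... | no  t*r≰K = ⊥-elim (1+n≰n (≤-trans (requestInside 𝒞 isMCBC S (≰⇒> t*r≰K)) ∣S∣≤K))

coeff : ℕ → ℕ → ℕ → ℕ
coeff m K i = (m ∸ i) C (K ∸ i)

itemWeight≤supersets : ∀ {m} K r (v : Subset m) → r ≤ K →
  sumFrom r (suc K ∸ r) (λ i → coeff m K i * δ ∣ v ∣ i) ≤ supersets K v
itemWeight≤supersets {m} K r v r≤K with ∣ v ∣ ≤? K
... | yes d≤K = ≤-trans (sumFrom-δ-≤ r (suc K ∸ r) (coeff m K) ∣ v ∣)
                        (≤-reflexive (sym (supersets-closed K v d≤K)))
... | no  d≰K = ≤-trans (≤-reflexive (sumFrom-δ-outside r (suc K ∸ r) (coeff m K) ∣ v ∣ beyond)) z≤n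
  where
  beyond : ∀ i → r ≤ i → i < r + (suc K ∸ r) → ∣ v ∣ ≢ i
  beyond i _ i<1+K refl = d≰K (≤-pred (≤-trans i<1+K (≤-reflexive (m+[n∸m]≡n (m≤n⇒m≤1+n r≤K)))))

lemma3 : (n N k m r : ℕ) → .{{_ : NonZero n}} → .{{_ : NonZero k}} → .{{_ : NonZero m}} → .{{_ : NonZero r}} →
    r ≤ k ∸ 1 → k ≤ m →
    (𝒞 : Code n m) → IsMCBC n N k m r 𝒞 →
    sumFrom r (k ∸ r) (λ i → ((m ∸ i) C (k ∸ 1 ∸ i)) * A 𝒞 i) ≤ ((k ∸ 1) / r) * (m C (k ∸ 1))
lemma3 n N (suc K) m r r≤K _ 𝒞 isMCBC = begin
  sumFrom r (suc K ∸ r) (λ i → coeff m K i * A 𝒞 i)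
    ≡⟨ sumFrom-cong r (suc K ∸ r) (λ i → trans (cong (coeff m K i *_) (A≡∑ 𝒞 i))
                                              (*-distribˡ-sum (coeff m K i) (λ ℓ → δ (size ℓ) i))) ⟩
  sumFrom r (suc K ∸ r) (λ i → ∑[ ℓ < n ] (coeff m K i * δ (size ℓ) i))
    ≡⟨ sumFrom-∑ r (suc K ∸ r) (λ i ℓ → coeff m K i * δ (size ℓ) i) ⟩
  ∑[ ℓ < n ] sumFrom r (suc K ∸ r) (λ i → coeff m K i * δ (size ℓ) i)
    ≤⟨ ∑-mono-≤ (λ ℓ → itemWeight≤supersets K r (servers 𝒞 ℓ) r≤K) ⟩
  ∑[ ℓ < n ] supersets K (servers 𝒞 ℓ)
    ≤⟨ supersetBound-all m K (K / r) (servers 𝒞)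
         (λ S ∣S∣≡K → fewItemsInside r 𝒞 isMCBC S (≤-reflexive ∣S∣≡K)) ⟩
  (K / r) * (m C K) ∎
  where
  size : Fin n → ℕ
  size ℓ = ∣ servers 𝒞 ℓ ∣
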